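{- In the Warden's Game with position set $\mathbf{S}$ and goal $\alpha$, for any $\beta\in\mathbf{S}$, the prisoner can win starting from $\beta$ (i.e., has a strategy guaranteeing that the position equals $\alpha$ after some finite number $\ge1$ of moves, whatever the warden does) if and only if $\beta$ is increasable in $\mathbf{S}$ to a rotation of $\alpha$.
   Context: $\mathbf{T}(n,k)$ is the set of strings of length $n$ over $\{1,\ldots,k\}$; $\mathbf{S}\subseteq\mathbf{T}(n,k)$ is closed under rotations (cyclic shifts), and $\alpha\in\mathbf{S}$. Warden's Game: positions are elements of $\mathbf{S}$. From a position $\gamma c$ ($\gamma$ of length $n-1$, $c$ the last symbol), the warden may either move to $c'\gamma$ for some symbol $c'<c$ with $c'\gamma\in\mathbf{S}$, or pass; if he passes, the prisoner must move to $c'\gamma$ for some symbol $c'\ge c$ with $c'\gamma\in\mathbf{S}$. The prisoner wins as soon as the position equals $\alpha$ after some move (the starting position does not count). For $\beta,\delta\in\mathbf{S}$, $\beta$ is increasable in $\mathbf{S}$ to $\delta$ if there is a sequence $\beta=\delta_0,\ldots,\delta_t=\delta$ ($t\ge0$) of elements of $\mathbf{S}$, each obtained from the previous by strictly increasing exactly one symbol. -}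

module Defs where

open import Data.Nat using (ℕ; zero; suc)
open import Data.Fin using (Fin; _<_; _≤_)
open import Data.Vec using (Vec; []; _∷_; _∷ʳ_; init; last; lookup)
open import Data.Product using (Σ; ∃; _×_; _,_)
open import Data.Sum using (_⊎_)
open import Relation.Binary.PropositionalEquality using (_≡_; _≢_)
open import Relation.Binary.Construct.Closure.ReflexiveTransitive using (Star)
open import Relation.Nullary using (¬_)

-- Strings of length n over an alphabet of k symbols (symbol i+1 is
-- represented by  i : Fin k ; the order of Fin k is the order of symbols).
Str : ℕ → ℕ → Set
Str n k = Vec (Fin k) n

rotate : ∀ {n k} → Str n k → Str n k
rotate {zero}  []       = []
rotate {suc n} (x ∷ xs) = xs ∷ʳ x

rotateN : ∀ {n k} → ℕ → Str n k → Str n k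
rotateN zero    v = v
rotateN (suc i) v = rotate (rotateN i v)

IsRotationOf : ∀ {n k} → Str n k → Str n k → Set
IsRotationOf u v = ∃ λ i → rotateN i v ≡ u

RotationClosed : ∀ {n k} → (Str n k → Set) → Set
RotationClosed {n} {k} S = ∀ (i : ℕ) (v : Str n k) → S v → S (rotateN i v)

WardenMove : ∀ {n k} → (Str (suc n) k → Set) → Str (suc n) k → Str (suc n) k → Set
WardenMove S v w = ∃ λ c' → (c' < last v) × (w ≡ c' ∷ init v) × S w

PrisonerMove : ∀ {n k} → (Str (suc n) k → Set) → Str (suc n) k → Str (suc n) k → Set
PrisonerMove S v w = ∃ λ c' → (last v ≤ c') × (w ≡ c' ∷ init v) × S w

-- This is the inductive
-- (well-founded, hence finite-time) attractor: whatever move the warden makes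
-- either lands on α or leads to a winning position, and if the warden passes
-- the prisoner has a move which lands on α or leads to a winning position.
data PrisonerWins {n k} (S : Str (suc n) k → Set) (α : Str (suc n) k)
                  : Str (suc n) k → Set where
  win : ∀ {β} →
        (∀ δ → WardenMove S β δ → δ ≡ α ⊎ PrisonerWins S α δ) →
        (∃ λ δ → PrisonerMove S β δ × (δ ≡ α ⊎ PrisonerWins S α δ)) →
        PrisonerWins S α β

IncreaseOne : ∀ {n k} → Str n k → Str n k → Set
IncreaseOne {n} β δ =
  ∃ λ (i : Fin n) → (lookup β i < lookup δ i) ×
                    (∀ (j : Fin n) → j ≢ i → lookup δ j ≡ lookup β j)

IncStep : ∀ {n k} → (Str n k → Set) → Str n k → Str n k → Set
IncStep S β δ = IncreaseOne β δ × S δ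

-- β is increasable in S to δ (β ∈ S is assumed separately).
Increasable : ∀ {n k} → (Str n k → Set) → Str n k → Str n k → Set
Increasable S = Star (IncStep S)

-- A move always drops the last symbol and prepends a new one, so the prisoner's reply that
-- prepends the dropped symbol again ("keep") merely rotates the position back by one.
-- If β can be raised symbol by symbol inside S to a rotation of α, the prisoner keeps until the
-- next raised symbol is last and then raises it; rotations of α are won by keeping until α
-- recurs.  Every warden move lowers the sum of the symbols and differs in a single symbol from
-- the reply the prisoner intended, so induction on that sum shows the warden cannot interfere.
-- Conversely, a prisoner reply c′γ to γc raises, after rotating, the last symbol of γc; read
-- along a winning play in which the warden always passes, the replies give the required chain.
module Submission where

open import Defs
open import Data.Nat using (ℕ; suc)
open import Data.Product using (∃; _×_)
open import Function.Bundles using (_⇔_)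

open import Data.Nat as ℕ using (zero; _+_)
import Data.Nat.Properties as ℕ
open import Data.Nat.Induction using (<-wellFounded)
open import Data.Fin as Fin using (Fin; toℕ)
open import Data.Fin.Properties using (_≟_; ≤∧≢⇒<; suc-injective)
open import Data.Vec using ([]; _∷_; _∷ʳ_; init; last; initLast; toList)
import Data.Vec.Properties as Vec
open import Data.List using (List; []; _∷_; _++_; [_]; length)
import Data.List.Properties as List
open import Data.Product using (_,_; proj₂; map₁; map₂)
open import Data.Sum using (_⊎_; inj₁; inj₂)
open import Data.Empty using (⊥-elim)
open import Function.Base using (_∘_)
open import Function.Bundles using (mk⇔)
open import Induction.WellFounded using (Acc; acc)
open import Relation.Binary.PropositionalEquality
  using (_≡_; refl; sym; trans; cong; cong₂; subst; module ≡-Reasoning)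
open import Relation.Binary.Construct.Closure.ReflexiveTransitive using (ε; _◅_; _◅◅_; gmap)
open import Relation.Nullary using (yes; no)

module _ {k : ℕ} where

  private
    rotateᴸ : List (Fin k) → List (Fin k)
    rotateᴸ []       = []
    rotateᴸ (x ∷ xs) = xs ++ [ x ]

    rotateᴸN : ℕ → List (Fin k) → List (Fin k)
    rotateᴸN zero    xs = xs
    rotateᴸN (suc i) xs = rotateᴸN i (rotateᴸ xs)

    rotateᴸN-++ : ∀ p q → rotateᴸN (length p) (p ++ q) ≡ q ++ p
    rotateᴸN-++ []      q = sym (List.++-identityʳ q)
    rotateᴸN-++ (x ∷ p) q = begin
      rotateᴸN (length p) ((p ++ q) ++ [ x ]) ≡⟨ cong (rotateᴸN (length p)) (List.++-assoc p q [ x ]) ⟩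
      rotateᴸN (length p) (p ++ (q ++ [ x ])) ≡⟨ rotateᴸN-++ p (q ++ [ x ]) ⟩
      (q ++ [ x ]) ++ p                       ≡⟨ List.++-assoc q [ x ] p ⟩
      q ++ x ∷ p                              ∎
      where open ≡-Reasoning

    rotateᴸN-length : ∀ xs → rotateᴸN (length xs) xs ≡ xs
    rotateᴸN-length xs =
      trans (cong (rotateᴸN (length xs)) (sym (List.++-identityʳ xs))) (rotateᴸN-++ xs [])

  rotateN-+ : ∀ {n} i j (v : Str n k) → rotateN (i + j) v ≡ rotateN i (rotateN j v)
  rotateN-+ zero    j v = refl
  rotateN-+ (suc i) j v = cong rotate (rotateN-+ i j v)

  rotateN-suc : ∀ {n} i (v : Str n k) → rotateN (suc i) v ≡ rotateN i (rotate v)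
  rotateN-suc i v = trans (cong (λ m → rotateN m v) (ℕ.+-comm 1 i)) (rotateN-+ i 1 v)

  private
    toList-rotate : ∀ {n} (v : Str n k) → toList (rotate v) ≡ rotateᴸ (toList v)
    toList-rotate []       = refl
    toList-rotate (x ∷ xs) = Vec.toList-∷ʳ x xs

    toList-rotateN : ∀ {n} i (v : Str n k) → toList (rotateN i v) ≡ rotateᴸN i (toList v)
    toList-rotateN zero    v = refl
    toList-rotateN (suc i) v = begin
      toList (rotateN (suc i) v)      ≡⟨ cong toList (rotateN-suc i v) ⟩
      toList (rotateN i (rotate v))   ≡⟨ toList-rotateN i (rotate v) ⟩
      rotateᴸN i (toList (rotate v))  ≡⟨ cong (rotateᴸN i) (toList-rotate v) ⟩
      rotateᴸN i (rotateᴸ (toList v)) ∎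
      where open ≡-Reasoning

  rotateN-period : ∀ {n} (v : Str n k) → rotateN n v ≡ v
  rotateN-period {n} v =
    trans (sym (Vec.cast-is-id refl (rotateN n v))) (Vec.toList-injective refl (rotateN n v) v same-list)
    where
    open ≡-Reasoning
    same-list : toList (rotateN n v) ≡ toList v
    same-list = begin
      toList (rotateN n v)                    ≡⟨ toList-rotateN n v ⟩
      rotateᴸN n (toList v)                   ≡⟨ cong (λ m → rotateᴸN m (toList v)) (sym (Vec.length-toList v)) ⟩
      rotateᴸN (length (toList v)) (toList v) ≡⟨ rotateᴸN-length (toList v) ⟩
      toList v                                ∎

  unrotate : ∀ {n} → Str (suc n) k → Str (suc n) k
  unrotate v = last v ∷ init v

  unrotateN : ∀ {n} → ℕ → Str (suc n) k → Str (suc n) k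
  unrotateN zero    v = v
  unrotateN (suc i) v = unrotateN i (unrotate v)

  rotate-unrotate : ∀ {n} (v : Str (suc n) k) → rotate (unrotate v) ≡ v
  rotate-unrotate v = sym (proj₂ (proj₂ (initLast v)))

  unrotate-rotate : ∀ {n} (v : Str (suc n) k) → unrotate (rotate v) ≡ v
  unrotate-rotate (x ∷ xs) = cong₂ _∷_ (Vec.last-∷ʳ x xs) (Vec.init-∷ʳ x xs)

  unrotateN-rotateN : ∀ {n} i (v : Str (suc n) k) → unrotateN i (rotateN i v) ≡ v
  unrotateN-rotateN zero    v = refl
  unrotateN-rotateN (suc i) v =
    trans (cong (unrotateN i) (unrotate-rotate (rotateN i v))) (unrotateN-rotateN i v)

  unrotateN-+ : ∀ {n} i j (v : Str (suc n) k) → unrotateN (i + j) v ≡ unrotateN j (unrotateN i v)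
  unrotateN-+ zero    j v = refl
  unrotateN-+ (suc i) j v = unrotateN-+ i j (unrotate v)

  rotateN≡unrotate : ∀ {n} (v : Str (suc n) k) → rotateN n v ≡ unrotate v
  rotateN≡unrotate {n} v = begin
    rotateN n v                       ≡⟨ cong (rotateN n) (sym (rotate-unrotate v)) ⟩
    rotateN n (rotate (unrotate v))   ≡⟨ sym (rotateN-suc n (unrotate v)) ⟩
    rotateN (suc n) (unrotate v)      ≡⟨ rotateN-period (unrotate v) ⟩
    unrotate v                        ∎
    where open ≡-Reasoning

  unrotateN-period : ∀ {n} (v : Str (suc n) k) → unrotateN (suc n) v ≡ v
  unrotateN-period {n} v =
    trans (cong (unrotateN (suc n)) (sym (rotateN-period v))) (unrotateN-rotateN (suc n) v)

  rotate-isRotation : ∀ {n} {ρ α : Str n k} → IsRotationOf ρ α → IsRotationOf (rotate ρ) α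
  rotate-isRotation (i , eq) = suc i , cong rotate eq

  unrotate-isRotation : ∀ {n} {ρ α : Str (suc n) k} →
                        IsRotationOf ρ α → IsRotationOf (unrotate ρ) α
  unrotate-isRotation {n} {α = α} (i , refl) = n + i , trans (rotateN-+ n i α) (rotateN≡unrotate _)

  unrotateN-isRotation : ∀ {n} r {ρ α : Str (suc n) k} →
                         IsRotationOf ρ α → IsRotationOf (unrotateN r ρ) α
  unrotateN-isRotation zero    rot = rot
  unrotateN-isRotation (suc r) rot = unrotateN-isRotation r (unrotate-isRotation rot)

  isRotation⇒rotateN-suc : ∀ {n} {ρ α : Str (suc n) k} →
                           IsRotationOf ρ α → ∃ λ i → rotateN (suc i) α ≡ ρ
  isRotation⇒rotateN-suc {n} {α = α} (zero  , refl) = n , rotateN-period α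
  isRotation⇒rotateN-suc             (suc i , eq)   = i , eq

  -- d counts the symbols after the increased one.
  data IncreaseAt : ℕ → ∀ {m} → Str m k → Str m k → Set where
    here  : ∀ {m a b} {xs : Str m k} → a Fin.< b → IncreaseAt m (a ∷ xs) (b ∷ xs)
    there : ∀ {d m x} {xs ys : Str m k} → IncreaseAt d xs ys → IncreaseAt d (x ∷ xs) (x ∷ ys)

  IncreaseAt⇒IncreaseOne : ∀ {d m} {v w : Str m k} → IncreaseAt d v w → IncreaseOne v w
  IncreaseAt⇒IncreaseOne (here a<b) = Fin.zero , a<b , λ
    { Fin.zero    j≢0 → ⊥-elim (j≢0 refl)
    ; (Fin.suc j) _   → refl }
  IncreaseAt⇒IncreaseOne (there p) with IncreaseAt⇒IncreaseOne p
  ... | i , lt , same = Fin.suc i , lt , λ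
    { Fin.zero    _   → refl
    ; (Fin.suc j) j≢i → same j (j≢i ∘ cong Fin.suc) }

  IncreaseOne⇒IncreaseAt : ∀ {m} {v w : Str m k} → IncreaseOne v w → ∃ λ d → IncreaseAt d v w
  IncreaseOne⇒IncreaseAt {v = x ∷ xs} {y ∷ ys} (Fin.zero , x<y , same) =
    subst (λ zs → ∃ λ d → IncreaseAt d (x ∷ xs) (y ∷ zs)) xs≡ys (_ , here x<y)
    where
    xs≡ys : xs ≡ ys
    xs≡ys = trans (sym (Vec.tabulate∘lookup xs))
              (trans (Vec.tabulate-cong (λ j → sym (same (Fin.suc j) λ ()))) (Vec.tabulate∘lookup ys))
  IncreaseOne⇒IncreaseAt {v = x ∷ xs} {y ∷ ys} (Fin.suc i , lt , same) rewrite same Fin.zero (λ ()) =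
    map₂ there (IncreaseOne⇒IncreaseAt (i , lt , λ j j≢i → same (Fin.suc j) (j≢i ∘ suc-injective)))

  IncreaseAt-last : ∀ {n} {v w : Str (suc n) k} →
                    IncreaseAt 0 v w → init v ≡ init w × last v Fin.< last w
  IncreaseAt-last {v = _ ∷ []}    (here a<b) = refl , a<b
  IncreaseAt-last {v = _ ∷ []}    (there ())
  IncreaseAt-last {v = _ ∷ _ ∷ _} (there p)  = map₁ (cong (_ ∷_)) (IncreaseAt-last p)

  IncreaseAt-init : ∀ {d n} {v w : Str (suc n) k} →
                    IncreaseAt (suc d) v w → last v ≡ last w × IncreaseAt d (init v) (init w)
  IncreaseAt-init {v = _ ∷ _ ∷ _} (here a<b) = refl , here a<b
  IncreaseAt-init {v = _ ∷ []}    (there ())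
  IncreaseAt-init {v = _ ∷ _ ∷ _} (there p)  = map₂ there (IncreaseAt-init p)

  IncreaseAt-unrotate : ∀ {d n} {v w : Str (suc n) k} →
                        IncreaseAt (suc d) v w → IncreaseAt d (unrotate v) (unrotate w)
  IncreaseAt-unrotate p with IncreaseAt-init p
  ... | lastEq , q rewrite lastEq = there q

  IncreaseAt-snoc : ∀ {m a b} (xs : Str m k) → a Fin.< b → IncreaseAt 0 (xs ∷ʳ a) (xs ∷ʳ b)
  IncreaseAt-snoc []       a<b = here a<b
  IncreaseAt-snoc (x ∷ xs) a<b = there (IncreaseAt-snoc xs a<b)

  IncreaseAt-∷ʳ : ∀ {d m c} {xs ys : Str m k} →
                  IncreaseAt d xs ys → IncreaseAt (suc d) (xs ∷ʳ c) (ys ∷ʳ c)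
  IncreaseAt-∷ʳ (here a<b) = here a<b
  IncreaseAt-∷ʳ (there p)  = there (IncreaseAt-∷ʳ p)

  IncreaseAt-rotate : ∀ {d n} {v w : Str n k} →
                      IncreaseAt d v w → ∃ λ d′ → IncreaseAt d′ (rotate v) (rotate w)
  IncreaseAt-rotate (here {xs = xs} a<b) = 0 , IncreaseAt-snoc xs a<b
  IncreaseAt-rotate (there p)            = _ , IncreaseAt-∷ʳ p

  IncreaseAt-last-unrotate : ∀ {n} {v w : Str (suc n) k} →
                             IncreaseAt 0 v w → IncreaseAt n (unrotate v) (unrotate w)
  IncreaseAt-last-unrotate p with IncreaseAt-last p
  ... | initEq , lastLt rewrite initEq = here lastLt

  IncreaseOne-rotate : ∀ {n} {v w : Str n k} → IncreaseOne v w → IncreaseOne (rotate v) (rotate w)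
  IncreaseOne-rotate {v = v} {w} inc =
    IncreaseAt⇒IncreaseOne (proj₂ (IncreaseAt-rotate (proj₂ (IncreaseOne⇒IncreaseAt {v = v} {w} inc))))

  IncreaseOne-unrotate : ∀ {n} {v w : Str (suc n) k} →
                         IncreaseOne v w → IncreaseOne (unrotate v) (unrotate w)
  IncreaseOne-unrotate {v = v} {w} inc with IncreaseOne⇒IncreaseAt {v = v} {w} inc
  ... | zero  , p = IncreaseAt⇒IncreaseOne (IncreaseAt-last-unrotate p)
  ... | suc d , p = IncreaseAt⇒IncreaseOne (IncreaseAt-unrotate p)

  weight : ∀ {m} → Str m k → ℕ
  weight []       = 0
  weight (x ∷ xs) = toℕ x + weight xs

  weight-∷ʳ : ∀ {m} x (xs : Str m k) → weight (xs ∷ʳ x) ≡ weight xs + toℕ x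
  weight-∷ʳ x []       = ℕ.+-identityʳ (toℕ x)
  weight-∷ʳ x (y ∷ xs) =
    trans (cong (toℕ y +_) (weight-∷ʳ x xs)) (sym (ℕ.+-assoc (toℕ y) (weight xs) (toℕ x)))

  weight-unrotate : ∀ {n} (v : Str (suc n) k) → weight (unrotate v) ≡ weight v
  weight-unrotate v = begin
    toℕ (last v) + weight (init v)  ≡⟨ ℕ.+-comm (toℕ (last v)) (weight (init v)) ⟩
    weight (init v) + toℕ (last v)  ≡⟨ sym (weight-∷ʳ (last v) (init v)) ⟩
    weight (init v ∷ʳ last v)       ≡⟨ cong weight (rotate-unrotate v) ⟩
    weight v                        ∎
    where open ≡-Reasoning

  weight-lower-last : ∀ {n c} (v : Str (suc n) k) → c Fin.< last v → weight (c ∷ init v) ℕ.< weight v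
  weight-lower-last v c<last =
    subst (weight (_ ∷ init v) ℕ.<_) (weight-unrotate v) (ℕ.+-monoˡ-< (weight (init v)) c<last)

module WardensGame {n k : ℕ} (S : Str (suc n) k → Set) (rotationClosed : RotationClosed S)
                   (α : Str (suc n) k) where

  Winning : Str (suc n) k → Set
  Winning = PrisonerWins S α

  WinningOrGoal : Str (suc n) k → Set
  WinningOrGoal u = u ≡ α ⊎ Winning u

  S-unrotate : ∀ {v} → S v → S (unrotate v)
  S-unrotate {v} Sv = subst S (rotateN≡unrotate v) (rotationClosed n v Sv)

  S-unrotateN : ∀ r {v} → S v → S (unrotateN r v)
  S-unrotateN zero    Sv = Sv
  S-unrotateN (suc r) Sv = S-unrotateN r (S-unrotate Sv)

  keepMove : ∀ {v} → S v → PrisonerMove S v (unrotate v)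
  keepMove {v} Sv = last v , ℕ.≤-refl , refl , S-unrotate Sv

  -- After d keep moves and the raising reply, the prisoner stands at unrotateN (suc d) w.
  mutual
    reply-wins : ∀ {s v u} → Acc ℕ._<_ s → weight v ≡ s →
                 PrisonerMove S v u → WinningOrGoal u → Winning v
    reply-wins {v = v} (acc smaller) refl reply@(_ , last≤a , refl , Su) u-wins =
      win wardenMove (_ , reply , u-wins)
      where
      wardenMove : ∀ δ → WardenMove S v δ → WinningOrGoal δ
      wardenMove _ (_ , c<last , refl , Sδ) =
        inj₂ (increaseAt-wins (smaller (weight-lower-last v c<last)) n refl Sδ Su
                (here (ℕ.<-≤-trans c<last last≤a))
                (subst WinningOrGoal (sym (unrotateN-period _)) u-wins))

    increaseAt-wins : ∀ {s} → Acc ℕ._<_ s → ∀ d {v w} → weight v ≡ s → S v → S w →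
                      IncreaseAt d v w → WinningOrGoal (unrotateN (suc d) w) → Winning v
    increaseAt-wins a zero {w = w} e Sv Sw p w-wins with IncreaseAt-last p
    ... | initEq , lastLt =
      reply-wins a e (last w , ℕ.<⇒≤ lastLt , cong (last w ∷_) (sym initEq) , S-unrotate Sw) w-wins
    increaseAt-wins a (suc d) {v} e Sv Sw p w-wins = reply-wins a e (keepMove Sv) (inj₂ unrotate-wins)
      where
      unrotate-wins : Winning (unrotate v)
      unrotate-wins = increaseAt-wins a d (trans (weight-unrotate v) e) (S-unrotate Sv) (S-unrotate Sw)
                    (IncreaseAt-unrotate p) w-wins

  keep-wins : ∀ {v} → S v → WinningOrGoal (unrotate v) → Winning v
  keep-wins Sv = reply-wins (<-wellFounded _) refl (keepMove Sv)

  unrotateN≡goal⇒wins : ∀ j {v} → S v → unrotateN (suc j) v ≡ α → Winning v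
  unrotateN≡goal⇒wins zero    Sv eq = keep-wins Sv (inj₁ eq)
  unrotateN≡goal⇒wins (suc j) Sv eq = keep-wins Sv (inj₂ (unrotateN≡goal⇒wins j (S-unrotate Sv) eq))

  rotation-wins : S α → ∀ {ρ} → IsRotationOf ρ α → Winning ρ
  rotation-wins Sα rot with isRotation⇒rotateN-suc rot
  ... | i , refl = unrotateN≡goal⇒wins i (rotationClosed (suc i) α Sα) (unrotateN-rotateN (suc i) α)

  RotationsWin : Str (suc n) k → Set
  RotationsWin v = ∀ r → Winning (unrotateN r v)

  incStep-wins : ∀ {v w} → S v → IncStep S v w → RotationsWin w → Winning v
  incStep-wins {v} {w} Sv (inc , Sw) w-wins with IncreaseOne⇒IncreaseAt {v = v} {w} inc
  ... | d , p = increaseAt-wins (<-wellFounded _) d refl Sv Sw p (inj₂ (w-wins (suc d)))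

  IncStep-unrotateN : ∀ r {v w} → IncStep S v w → IncStep S (unrotateN r v) (unrotateN r w)
  IncStep-unrotateN zero    step       = step
  IncStep-unrotateN (suc r) (inc , Sw) =
    IncStep-unrotateN r (IncreaseOne-unrotate inc , S-unrotate Sw)

  increasable⇒rotationsWin : S α → ∀ {v ρ} → S v →
                             Increasable S v ρ → IsRotationOf ρ α → RotationsWin v
  increasable⇒rotationsWin Sα Sv ε               rot r = rotation-wins Sα (unrotateN-isRotation r rot)
  increasable⇒rotationsWin Sα Sv (step ◅ steps) rot r =
    incStep-wins (S-unrotateN r Sv) (IncStep-unrotateN r step) λ r′ →
      subst Winning (unrotateN-+ r r′ _) (increasable⇒rotationsWin Sα (proj₂ step) steps rot (r + r′))

  IncreasableToRotation : Str (suc n) k → Set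
  IncreasableToRotation v = ∃ λ ρ → IsRotationOf ρ α × Increasable S v ρ

  IncStep-rotate : ∀ {v w} → IncStep S v w → IncStep S (rotate v) (rotate w)
  IncStep-rotate {v} {w} (inc , Sw) = IncreaseOne-rotate {v = v} {w} inc , rotationClosed 1 w Sw

  prisonerMove-increasable : ∀ {v u} → PrisonerMove S v u → Increasable S v (rotate u)
  prisonerMove-increasable {v} (c , last≤c , refl , Su) with last v ≟ c
  ... | yes refl = subst (Increasable S v) (sym (rotate-unrotate v)) ε
  ... | no last≢c = (raise-last , rotationClosed 1 _ Su) ◅ ε
    where
    raise-last : IncreaseOne v (rotate (c ∷ init v))
    raise-last = subst (λ x → IncreaseOne x (rotate (c ∷ init v))) (rotate-unrotate v)
                   (IncreaseOne-rotate {v = unrotate v} {c ∷ init v}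
                     (IncreaseAt⇒IncreaseOne (here (≤∧≢⇒< last≤c last≢c))))

  prisonerMove-increasableToRotation : ∀ {v u} → PrisonerMove S v u →
                                       IncreasableToRotation u → IncreasableToRotation v
  prisonerMove-increasableToRotation move (ρ , rot , steps) =
    rotate ρ , rotate-isRotation rot ,
    prisonerMove-increasable move ◅◅ gmap rotate (λ {v} {w} → IncStep-rotate {v} {w}) steps

  mutual
    wins⇒increasableToRotation : ∀ {v} → Winning v → IncreasableToRotation v
    wins⇒increasableToRotation (win _ (_ , move , u-wins)) =
      prisonerMove-increasableToRotation move (winningOrGoal⇒increasableToRotation u-wins)

    winningOrGoal⇒increasableToRotation : ∀ {u} → WinningOrGoal u → IncreasableToRotation u
    winningOrGoal⇒increasableToRotation (inj₁ refl)   = α , (0 , refl) , ε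
    winningOrGoal⇒increasableToRotation (inj₂ u-wins) = wins⇒increasableToRotation u-wins

mainTheorem3 : (n k : ℕ) (S : Str (suc n) k → Set) → RotationClosed S →
    (α β : Str (suc n) k) → S α → S β →
    PrisonerWins S α β ⇔ (∃ λ ρ → IsRotationOf ρ α × Increasable S β ρ)
mainTheorem3 n k S rotationClosed α β Sα Sβ =
  mk⇔ wins⇒increasableToRotation
      (λ { (ρ , rot , steps) → increasable⇒rotationsWin Sα Sβ steps rot 0 })
  where open WardensGame S rotationClosed α
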